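{- Let $\lambda=(\lambda_1,\dots,\lambda_m)$ be a non-increasing sequence of positive integers, and for each $j\ge 1$ let $h_j=|\{i : \lambda_i\ge j\}|$ be the height of the $j$-th column of a diagram of shape $\lambda$. Then the maximum number of inversions of any inverted Young tableau of shape $\lambda$ is $$M_\lambda=\sum_j T_{h_j-1}=\sum_j\binom{h_j}{2},$$ where $T_k=k(k+1)/2$ is the $k$-th triangular number. Moreover, exactly one inverted Young tableau of shape $\lambda$ has $M_\lambda$ inversions, i.e. $|S_{M_\lambda}(\lambda)|=1$.
   Context: Let $N=\lambda_1+\dots+\lambda_m$. A tableau of shape $\lambda$ is a bijective filling of the (left-justified, $\lambda_i$ boxes in row $i$) Young diagram with $1,\dots,N$; it is row-standard if entries increase left to right along each row. An inverted Young tableau of shape $\lambda$ is a row-standard tableau of shape $\lambda$. For a row-standard tableau $\tau$, a pair of entries $i<j$ in the same column is an inversion if either (1) $i$ or $j$ has no entry immediately to its right and $i$ lies below $j$, or (2) $i$ is immediately followed on its right by $i'$, $j$ is immediately followed on its right by $j'$, and $i'>j'$. $S_i(\lambda)$ denotes the set of row-standard tableaux of shape $\lambda$ with exactly $i$ inversions. -}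

module Defs where

open import Data.Nat using (ℕ; zero; suc; _+_; _<_; _≤_; _≥_; _<ᵇ_; _⊔_)
open import Data.Nat.Combinatorics using (_C_)
open import Data.Bool using (Bool; true; false; if_then_else_)
open import Data.Maybe using (Maybe; just; nothing)
open import Data.Product using (_×_; _,_)
open import Data.List using (List; []; _∷_; map; length; concat; upTo; foldr)
open import Data.Nat.ListAction using (sum)
open import Relation.Binary.PropositionalEquality using (_≡_)
open import Data.List.Relation.Unary.All using (All)
open import Data.List.Relation.Unary.Linked using (Linked)
open import Data.List.Relation.Binary.Permutation.Propositional using (_↭_)

IsPartition : List ℕ → Set
IsPartition la = All (λ x → 1 ≤ x) la × Linked _≥_ la

size : List ℕ → ℕ
size la = sum la

-- A tableau is given as its list of rows (top row first).
Tableau : Set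
Tableau = List (List ℕ)

IsRowStandard : List ℕ → Tableau → Set
IsRowStandard la T =
  map length T ≡ la × (concat T ↭ map suc (upTo (size la))) × All (Linked _<_) T

cellAt : List ℕ → ℕ → Maybe (ℕ × Maybe ℕ)
cellAt []           _       = nothing
cellAt (x ∷ [])     zero    = just (x , nothing)
cellAt (x ∷ y ∷ ys) zero    = just (x , just y)
cellAt (x ∷ xs)     (suc c) = cellAt xs c

column : Tableau → ℕ → List (ℕ × Maybe ℕ)
column []       c = []
column (r ∷ rs) c with cellAt r c
... | just p  = p ∷ column rs c
... | nothing = column rs c

-- Given a cell u = (a, a') lying above a cell v = (b, b') in the same column,
-- decide whether the pair {a, b} is an inversion (i = min, j = max):
--  (1) one of them has no right neighbour and the smaller one lies below;
--  (2) both have right neighbours i', j' and i' > j'.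
isInv : ℕ × Maybe ℕ → ℕ × Maybe ℕ → Bool
isInv (a , just a') (b , just b') = if a <ᵇ b then b' <ᵇ a' else a' <ᵇ b'
isInv (a , just _)  (b , nothing) = b <ᵇ a
isInv (a , nothing) (b , _)       = b <ᵇ a

count : {A : Set} → (A → Bool) → List A → ℕ
count p []       = 0
count p (x ∷ xs) = (if p x then 1 else 0) + count p xs

pairInvs : List (ℕ × Maybe ℕ) → ℕ
pairInvs []       = 0
pairInvs (u ∷ us) = count (isInv u) us + pairInvs us

-- number of columns considered: columns 0 … (total entries − 1) cover all
-- (further columns are empty)
inversions : Tableau → ℕ
inversions T = sum (map (λ c → pairInvs (column T c)) (upTo (sum (map length T))))

width : List ℕ → ℕ
width la = foldr _⊔_ 0 la

height : List ℕ → ℕ → ℕ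
height la j = count (λ x → if x <ᵇ j then false else true) la

M : List ℕ → ℕ
M la = sum (map (λ j → height la j C 2) (map suc (upTo (width la))))

-- The c-th column has h = h_{c+1} cells and hence at most C(h,2) inversions; summing over the
-- columns gives the bound M_λ, with equality exactly when every pair of cells in every column is
-- inverted.  Such a "maximal" tableau exists: fill the columns from right to left with consecutive
-- blocks of values, giving a cell with right neighbour y the entry 2K+1−y (which reverses the order
-- of the next column) and the cells ending their rows smaller, decreasing values.  It is unique:
-- in a maximal tableau the first column holds entries smaller than everything to its right, and
-- its cells are ordered oppositely to their right neighbours.  By induction over the columns, two
-- maximal tableaux T and U of the same shape therefore order any two cells in the same way, and
-- since both are fillings by 1, …, N, each entry, being one more than the number of smaller
-- entries, is the same in T and in U.

module Submission where

open import Defs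
open import Data.Bool using (Bool; true; false; if_then_else_)
import Data.Bool as Bool
open import Data.Bool.Properties using (T-≡)
open import Data.List
  using (List; []; _∷_; [_]; _++_; map; length; concat; upTo; applyUpTo; zip; zipWith; mapMaybe; catMaybes; head; drop)
open import Data.List.Membership.Propositional using (_∈_)
open import Data.List.Membership.Propositional.Properties using (∈-map⁺)
open import Data.List.Properties
  using ( upTo-∷ʳ; map-++; map-∘; map-cong; map-cong-local; map-applyUpTo; mapMaybe-cong; drop-map; length-drop
        ; length-map; concat-map; ∷-injective; ∷-injectiveˡ; ∷-injectiveʳ)
open import Data.List.Relation.Binary.Permutation.Propositional as ↭
  using (_↭_; ↭-sym; ↭⇒↭ₛ; module PermutationReasoning)
open import Data.List.Relation.Binary.Permutation.Propositional.Properties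
  using (++⁺ˡ; ++⁺; ++-comm; shifts; map⁺; All-resp-↭)
import Data.List.Relation.Binary.Permutation.Setoid.Properties as Permutationₛ
open import Data.List.Relation.Unary.All as All using (All; []; _∷_)
import Data.List.Relation.Unary.All.Properties as All
open import Data.List.Relation.Unary.AllPairs as AllPairs using (AllPairs; []; _∷_)
import Data.List.Relation.Unary.AllPairs.Properties as AllPairs
open import Data.List.Relation.Unary.Any using (here; there)
open import Data.List.Relation.Unary.Linked as Linked using (Linked; []; [-]; _∷_)
import Data.List.Relation.Unary.Linked.Properties as Linked
open import Data.Maybe using (Maybe; just; nothing)
open import Data.Maybe.Properties using (just-injective)
open import Data.Nat
open import Data.Nat.Combinatorics using (_C_; nCk+nC[k+1]≡[n+1]C[k+1]; nC1≡n)
open import Data.Nat.ListAction using (sum)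
open import Data.Nat.ListAction.Properties using (sum-++)
open import Data.Nat.Properties
open import Algebra.Properties.CommutativeSemigroup +-commutativeSemigroup using (x∙yz≈y∙xz)
open import Data.Product using (_×_; _,_; proj₁; proj₂; ∃-syntax)
open import Data.Sum using (_⊎_; inj₁; inj₂)
open import Function using (_∘_; id; flip; _⇔_; mk⇔; Equivalence)
import Function.Properties.Equivalence as ⇔
open import Relation.Binary.Definitions using (tri<; tri≈; tri>)
open import Relation.Binary.PropositionalEquality hiding ([_])
open import Relation.Nullary using (contradiction; yes; no)

open Equivalence using (to; from)

<ᵇ≡true⇒< : ∀ {m n} → (m <ᵇ n) ≡ true → m < n
<ᵇ≡true⇒< {m} {n} eq = <ᵇ⇒< m n (from T-≡ eq)

<⇒<ᵇ≡true : ∀ {m n} → m < n → (m <ᵇ n) ≡ true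
<⇒<ᵇ≡true m<n = to T-≡ (<⇒<ᵇ m<n)

<ᵇ≡false⇒≥ : ∀ {m n} → (m <ᵇ n) ≡ false → n ≤ m
<ᵇ≡false⇒≥ eq = ≮⇒≥ (λ m<n → subst Bool.T eq (<⇒<ᵇ m<n))

≥⇒<ᵇ≡false : ∀ {m n} → n ≤ m → (m <ᵇ n) ≡ false
≥⇒<ᵇ≡false {m} {n} n≤m with m <ᵇ n in eq
... | false = refl
... | true  = contradiction (<ᵇ≡true⇒< eq) (≤⇒≯ n≤m)

⇔⇒<ᵇ≡ : ∀ {a b c d} → (a < b ⇔ c < d) → (a <ᵇ b) ≡ (c <ᵇ d)
⇔⇒<ᵇ≡ {a} {b} a<b⇔c<d with a <? b
... | yes a<b = trans (<⇒<ᵇ≡true a<b) (sym (<⇒<ᵇ≡true (to a<b⇔c<d a<b)))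
... | no  a≮b = trans (≥⇒<ᵇ≡false (≮⇒≥ a≮b)) (sym (≥⇒<ᵇ≡false (≮⇒≥ (a≮b ∘ from a<b⇔c<d))))

count-≤-length : ∀ {A : Set} (p : A → Bool) xs → count p xs ≤ length xs
count-≤-length p [] = z≤n
count-≤-length p (x ∷ xs) with p x
... | true  = s≤s (count-≤-length p xs)
... | false = m≤n⇒m≤1+n (count-≤-length p xs)

count≡length⇒All : ∀ {A : Set} (p : A → Bool) xs → count p xs ≡ length xs → All (λ x → p x ≡ true) xs
count≡length⇒All p [] _ = []
count≡length⇒All p (x ∷ xs) eq with p x in px
... | true  = px ∷ count≡length⇒All p xs (suc-injective eq)
... | false = contradiction eq (<⇒≢ (s≤s (count-≤-length p xs)))

All⇒count≡length : ∀ {A : Set} (p : A → Bool) {xs} → All (λ x → p x ≡ true) xs → count p xs ≡ length xs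
All⇒count≡length p [] = refl
All⇒count≡length p (px ∷ pxs) rewrite px = cong suc (All⇒count≡length p pxs)

All-false⇒count≡0 : ∀ {A : Set} (p : A → Bool) {xs} → All (λ x → p x ≡ false) xs → count p xs ≡ 0
All-false⇒count≡0 p [] = refl
All-false⇒count≡0 p (px ∷ pxs) rewrite px = All-false⇒count≡0 p pxs

count-↭ : ∀ {A : Set} (p : A → Bool) {xs ys} → xs ↭ ys → count p xs ≡ count p ys
count-↭ p ↭.refl          = refl
count-↭ p (↭.prep x q)    = cong (_ +_) (count-↭ p q)
count-↭ p (↭.swap x y q)  =
  trans (x∙yz≈y∙xz (indicator x) (indicator y) _) (cong (λ n → indicator y + (indicator x + n)) (count-↭ p q))
  where
  indicator : _ → ℕ
  indicator z = if p z then 1 else 0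
count-↭ p (↭.trans q q′)  = trans (count-↭ p q) (count-↭ p q′)

count-map-cong : ∀ {A : Set} (p q : ℕ → Bool) (f g : A → ℕ) {zs} → All (λ z → p (f z) ≡ q (g z)) zs →
                 count p (map f zs) ≡ count q (map g zs)
count-map-cong p q f g []          = refl
count-map-cong p q f g (eq ∷ eqs) = cong₂ _+_ (cong (if_then 1 else 0) eq) (count-map-cong p q f g eqs)

+-≤-≡⇒≡ : ∀ {m m′ n n′} → m ≤ m′ → n ≤ n′ → m + n ≡ m′ + n′ → m ≡ m′ × n ≡ n′
+-≤-≡⇒≡ {m} {m′} {n} {n′} m≤m′ n≤n′ eq =
  m≡m′ , +-cancelˡ-≡ m n n′ (trans eq (cong (_+ n′) (sym m≡m′)))
  where
  m≡m′ : m ≡ m′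
  m≡m′ = ≤-antisym m≤m′ (≮⇒≥ (λ m<m′ → <⇒≢ (+-mono-<-≤ m<m′ n≤n′) eq))

[1+n]C2≡n+nC2 : ∀ n → suc n C 2 ≡ n + n C 2
[1+n]C2≡n+nC2 n = trans (sym (nCk+nC[k+1]≡[n+1]C[k+1] n 1)) (cong (_+ n C 2) (nC1≡n n))

Inverted : ℕ × Maybe ℕ → ℕ × Maybe ℕ → Set
Inverted u v = isInv u v ≡ true

AllInverted : List (ℕ × Maybe ℕ) → Set
AllInverted = AllPairs Inverted

Inverted-⇔ : ∀ {a c a′ c′} → Inverted (a , just c) (a′ , just c′) → (a < a′ ⇔ c′ < c)
Inverted-⇔ {a} {c} {a′} {c′} inv with a <ᵇ a′ in a<ᵇa′
... | true  = mk⇔ (λ _ → <ᵇ≡true⇒< inv) (λ _ → <ᵇ≡true⇒< a<ᵇa′)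
... | false = mk⇔ (λ a<a′ → contradiction a<a′ (≤⇒≯ (<ᵇ≡false⇒≥ a<ᵇa′)))
                  (λ c′<c → contradiction (<ᵇ≡true⇒< inv) (<⇒≯ c′<c))

pairInvs-≤ : ∀ us → pairInvs us ≤ length us C 2
pairInvs-≤ [] = z≤n
pairInvs-≤ (u ∷ us) rewrite [1+n]C2≡n+nC2 (length us) =
  +-mono-≤ (count-≤-length (isInv u) us) (pairInvs-≤ us)

pairInvs≡C2⇒AllInverted : ∀ us → pairInvs us ≡ length us C 2 → AllInverted us
pairInvs≡C2⇒AllInverted [] _ = []
pairInvs≡C2⇒AllInverted (u ∷ us) eq
  with +-≤-≡⇒≡ (count-≤-length (isInv u) us) (pairInvs-≤ us) (trans eq ([1+n]C2≡n+nC2 (length us)))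
... | first , rest = count≡length⇒All (isInv u) us first ∷ pairInvs≡C2⇒AllInverted us rest

AllInverted⇒pairInvs≡C2 : ∀ {us} → AllInverted us → pairInvs us ≡ length us C 2
AllInverted⇒pairInvs≡C2 [] = refl
AllInverted⇒pairInvs≡C2 {u ∷ us} (first ∷ rest) rewrite [1+n]C2≡n+nC2 (length us) =
  cong₂ _+_ (All⇒count≡length (isInv u) first) (AllInverted⇒pairInvs≡C2 rest)

-- The upper bound

Σ< : (ℕ → ℕ) → ℕ → ℕ
Σ< f n = sum (map f (upTo n))

Σ<-suc : ∀ f n → Σ< f (suc n) ≡ Σ< f n + f n
Σ<-suc f n = begin
  sum (map f (upTo (suc n)))        ≡⟨ cong (λ xs → sum (map f xs)) (sym (upTo-∷ʳ n)) ⟩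
  sum (map f (upTo n ++ n ∷ []))    ≡⟨ cong sum (map-++ f (upTo n) (n ∷ [])) ⟩
  sum (map f (upTo n) ++ f n ∷ [])  ≡⟨ sum-++ (map f (upTo n)) (f n ∷ []) ⟩
  Σ< f n + (f n + 0)                ≡⟨ cong (Σ< f n +_) (+-identityʳ (f n)) ⟩
  Σ< f n + f n                      ∎
  where open ≡-Reasoning

Σ<-mono-≤ : ∀ {f g} n → (∀ {c} → c < n → f c ≤ g c) → Σ< f n ≤ Σ< g n
Σ<-mono-≤ zero f≤g = z≤n
Σ<-mono-≤ {f} {g} (suc n) f≤g rewrite Σ<-suc f n | Σ<-suc g n =
  +-mono-≤ (Σ<-mono-≤ n (f≤g ∘ m<n⇒m<1+n)) (f≤g ≤-refl)

Σ<-cong : ∀ {f g} n → (∀ {c} → c < n → f c ≡ g c) → Σ< f n ≡ Σ< g n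
Σ<-cong zero f≡g = refl
Σ<-cong {f} {g} (suc n) f≡g rewrite Σ<-suc f n | Σ<-suc g n =
  cong₂ _+_ (Σ<-cong n (f≡g ∘ m<n⇒m<1+n)) (f≡g ≤-refl)

Σ<-≡⇒≡ : ∀ {f g} n → (∀ {c} → c < n → f c ≤ g c) → Σ< f n ≡ Σ< g n →
         ∀ {c} → c < n → f c ≡ g c
Σ<-≡⇒≡ {f} {g} (suc n) f≤g eq c<1+n
  with +-≤-≡⇒≡ (Σ<-mono-≤ n (f≤g ∘ m<n⇒m<1+n)) (f≤g ≤-refl)
                (trans (sym (Σ<-suc f n)) (trans eq (Σ<-suc g n)))
     | m<1+n⇒m<n∨m≡n c<1+n
... | init , _    | inj₁ c<n  = Σ<-≡⇒≡ n (f≤g ∘ m<n⇒m<1+n) init c<n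
... | _    , last | inj₂ refl = last

Σ<-vanishing : ∀ f {w n} → w ≤ n → (∀ {c} → w ≤ c → f c ≡ 0) → Σ< f n ≡ Σ< f w
Σ<-vanishing f {w} {n} w≤n f≡0 with m≤n⇒∃[o]m+o≡n w≤n
... | k , refl = go k
  where
  open ≡-Reasoning
  go : ∀ k → Σ< f (w + k) ≡ Σ< f w
  go zero    = cong (Σ< f) (+-identityʳ w)
  go (suc k) = begin
    Σ< f (w + suc k)          ≡⟨ cong (Σ< f) (+-suc w k) ⟩
    Σ< f (suc (w + k))        ≡⟨ Σ<-suc f (w + k) ⟩
    Σ< f (w + k) + f (w + k)  ≡⟨ cong₂ _+_ (go k) (f≡0 (m≤m+n w k)) ⟩
    Σ< f w + 0                ≡⟨ +-identityʳ _ ⟩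
    Σ< f w                    ∎

cellAt-spec : ∀ r c → (cellAt r c ≡ nothing × length r ≤ c) ⊎ (∃[ u ] cellAt r c ≡ just u × c < length r)
cellAt-spec []           c       = inj₁ (refl , z≤n)
cellAt-spec (x ∷ [])     zero    = inj₂ (_ , refl , z<s)
cellAt-spec (x ∷ y ∷ ys) zero    = inj₂ (_ , refl , z<s)
cellAt-spec (x ∷ [])     (suc c) = inj₁ (refl , s≤s z≤n)
cellAt-spec (x ∷ y ∷ ys) (suc c) with cellAt-spec (y ∷ ys) c
... | inj₁ (eq , ≤c) = inj₁ (eq , s≤s ≤c)
... | inj₂ (u , eq , c<) = inj₂ (u , eq , s≤s c<)

length-column : ∀ T c → length (column T c) ≡ height (map length T) (suc c)
length-column []       c = refl
length-column (r ∷ rs) c with cellAt r c | cellAt-spec r c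
... | just _  | inj₂ (_ , _ , c<)  rewrite ≥⇒<ᵇ≡false {length r} {suc c} c<  = cong suc (length-column rs c)
... | nothing | inj₁ (_ , ≤c)      rewrite <⇒<ᵇ≡true {length r} {suc c} (s≤s ≤c) = length-column rs c
... | just _  | inj₁ (() , _)
... | nothing | inj₂ (_ , () , _)

parts≤width : ∀ la → All (_≤ width la) la
parts≤width []       = []
parts≤width (x ∷ la) =
  m≤m⊔n x (width la) ∷ All.map (λ ≤w → ≤-trans ≤w (m≤n⊔m x (width la))) (parts≤width la)

width≤size : ∀ la → width la ≤ size la
width≤size []       = z≤n
width≤size (x ∷ la) = ⊔-lub (m≤m+n x (sum la)) (≤-trans (width≤size la) (m≤n+m (sum la) x))

height-beyond-width : ∀ la {c} → width la ≤ c → height la (suc c) ≡ 0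
height-beyond-width la {c} w≤c =
  All-false⇒count≡0 _
    (All.map (λ {x} x≤w → cong (if_then false else true) (<⇒<ᵇ≡true {x} (s≤s (≤-trans x≤w w≤c))))
             (parts≤width la))

column-beyond-width : ∀ T {c} → width (map length T) ≤ c → column T c ≡ []
column-beyond-width T {c} w≤c with column T c | trans (length-column T c) (height-beyond-width (map length T) w≤c)
... | [] | _ = refl

columnBound : List ℕ → ℕ → ℕ
columnBound la c = height la (suc c) C 2

M≡Σ<-size : ∀ la → M la ≡ Σ< (columnBound la) (size la)
M≡Σ<-size la = begin
  M la                                     ≡⟨ cong sum (sym (map-∘ (upTo (width la)))) ⟩
  Σ< (columnBound la) (width la)           ≡⟨ Σ<-vanishing (columnBound la) (width≤size la)
                                                              (cong (_C 2) ∘ height-beyond-width la) ⟨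
  Σ< (columnBound la) (size la)            ∎
  where open ≡-Reasoning

pairInvs-column-≤ : ∀ T c → pairInvs (column T c) ≤ columnBound (map length T) c
pairInvs-column-≤ T c = subst (λ h → pairInvs (column T c) ≤ h C 2) (length-column T c) (pairInvs-≤ (column T c))

inversions-≤-M : ∀ T → inversions T ≤ M (map length T)
inversions-≤-M T = begin
  inversions T                                          ≤⟨ Σ<-mono-≤ (size la) (λ {c} _ → pairInvs-column-≤ T c) ⟩
  Σ< (columnBound la) (size la)                         ≡⟨ M≡Σ<-size la ⟨
  M la                                                  ∎
  where
  open ≤-Reasoning
  la = map length T

inversions≡M⇒AllInverted : ∀ T → inversions T ≡ M (map length T) → ∀ c → AllInverted (column T c)
inversions≡M⇒AllInverted T eq c with c <? size (map length T)
... | yes c<N = pairInvs≡C2⇒AllInverted (column T c)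
                  (trans (Σ<-≡⇒≡ (size (map length T)) (λ {c} _ → pairInvs-column-≤ T c)
                                 (trans eq (M≡Σ<-size (map length T))) c<N)
                         (cong (_C 2) (sym (length-column T c))))
... | no  c≮N = subst AllInverted (sym (column-beyond-width T (≤-trans (width≤size (map length T)) (≮⇒≥ c≮N)))) []

AllInverted⇒inversions≡M : ∀ T → (∀ c → AllInverted (column T c)) → inversions T ≡ M (map length T)
AllInverted⇒inversions≡M T full = begin
  inversions T                   ≡⟨ Σ<-cong (size la) (λ {c} _ → trans (AllInverted⇒pairInvs≡C2 (full c))
                                                                        (cong (_C 2) (length-column T c))) ⟩
  Σ< (columnBound la) (size la)  ≡⟨ M≡Σ<-size la ⟨
  M la                           ∎
  where
  open ≡-Reasoning
  la = map length T

-- u and v are explicit so that AllPairs.zip can infer relations of this form.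
_on-just_ : ∀ {A B : Set} → (B → B → Set) → (A → Maybe B) → A → A → Set
(R on-just f) x y = ∀ u v → f x ≡ just u → f y ≡ just v → R u v

module _ {A B : Set} (f : A → Maybe B) where

  All-mapMaybe⁺ : ∀ {P : B → Set} {xs} → All (λ x → ∀ {v} → f x ≡ just v → P v) xs → All P (mapMaybe f xs)
  All-mapMaybe⁺ {xs = []}     []          = []
  All-mapMaybe⁺ {xs = x ∷ xs} (Px ∷ Pxs) with f x
  ... | nothing = All-mapMaybe⁺ Pxs
  ... | just v  = Px refl ∷ All-mapMaybe⁺ Pxs

  All-mapMaybe⁻ : ∀ {P : B → Set} {xs} → All P (mapMaybe f xs) → All (λ x → ∀ {v} → f x ≡ just v → P v) xs
  All-mapMaybe⁻ {xs = []}     []  = []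
  All-mapMaybe⁻ {xs = x ∷ xs} Ps with f x in fx
  ... | nothing = (λ fx≡just → contradiction (trans (sym fx) fx≡just) λ ()) ∷ All-mapMaybe⁻ Ps
  All-mapMaybe⁻ {P = P} {x ∷ xs} (Pu ∷ Ps) | just u =
    (λ fx≡just → subst P (just-injective (trans (sym fx) fx≡just)) Pu) ∷ All-mapMaybe⁻ Ps

  AllPairs-mapMaybe⁺ : ∀ {R : B → B → Set} {xs} → AllPairs (R on-just f) xs → AllPairs R (mapMaybe f xs)
  AllPairs-mapMaybe⁺ {xs = []}     []          = []
  AllPairs-mapMaybe⁺ {xs = x ∷ xs} (Rx ∷ Rxs) with f x
  ... | nothing = AllPairs-mapMaybe⁺ Rxs
  ... | just u  = All-mapMaybe⁺ (All.map (λ Rxy {_} → Rxy u _ refl) Rx) ∷ AllPairs-mapMaybe⁺ Rxs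

  AllPairs-mapMaybe⁻ : ∀ {R : B → B → Set} {xs} → AllPairs R (mapMaybe f xs) → AllPairs (R on-just f) xs
  AllPairs-mapMaybe⁻ {xs = []}     []  = []
  AllPairs-mapMaybe⁻ {xs = x ∷ xs} Rs with f x in fx
  ... | nothing =
    All.tabulate (λ _ _ _ fx≡just → contradiction (trans (sym fx) fx≡just) λ ()) ∷ AllPairs-mapMaybe⁻ Rs
  AllPairs-mapMaybe⁻ {R = R} {x ∷ xs} (Ru ∷ Rs) | just u =
    All.map (λ Ruy _ _ fx≡just fy≡just →
               subst (λ w → R w _) (just-injective (trans (sym fx) fx≡just)) (Ruy fy≡just))
            (All-mapMaybe⁻ Ru)
    ∷ AllPairs-mapMaybe⁻ Rs

mapMaybe-map : ∀ {A B C : Set} (f : B → Maybe C) (g : A → B) xs → mapMaybe f (map g xs) ≡ mapMaybe (f ∘ g) xs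
mapMaybe-map f g xs = cong catMaybes (sym (map-∘ xs))

AllPairs-of-All : ∀ {A : Set} {P : A → Set} {xs} → All P xs → AllPairs (λ x y → P x × P y) xs
AllPairs-of-All []         = []
AllPairs-of-All (px ∷ pxs) = All.map (px ,_) pxs ∷ AllPairs-of-All pxs

AllPairs-++⁻ : ∀ {A : Set} {R : A → A → Set} xs {ys} → AllPairs R (xs ++ ys) →
               AllPairs R xs × AllPairs R ys
AllPairs-++⁻ []       Rys        = [] , Rys
AllPairs-++⁻ (x ∷ xs) (Rx ∷ Rxs) with AllPairs-++⁻ xs Rxs
... | Rxs′ , Rys = All.++⁻ˡ xs Rx ∷ Rxs′ , Rys

AllPairs-sym⇒All-All : ∀ {A : Set} {R : A → A → Set} {xs} → AllPairs (λ x y → R x y × R y x) xs →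
                       All (λ x → R x x) xs → All (λ x → All (R x) xs) xs
AllPairs-sym⇒All-All []         []         = []
AllPairs-sym⇒All-All (Rx ∷ Rxs) (rx ∷ rxs) =
  (rx ∷ All.map proj₁ Rx) ∷
  All.zipWith (λ (Ryx , Ry) → Ryx ∷ Ry) (All.map proj₂ Rx , AllPairs-sym⇒All-All Rxs rxs)

AllPairs-resp-↭ : ∀ {A : Set} {R : A → A → Set} → (∀ {x y} → R x y → R y x) →
                  ∀ {xs ys} → xs ↭ ys → AllPairs R xs → AllPairs R ys
AllPairs-resp-↭ {A} {R} sym xs↭ys = Permutationₛ.AllPairs-resp-↭ (setoid A) sym (resp₂ R) (↭⇒↭ₛ xs↭ys)

heads : ∀ {A : Set} → List (List A) → List A
heads = mapMaybe head

concat-↭-heads++tails : ∀ {A : Set} (rs : List (List A)) → concat rs ↭ heads rs ++ concat (map (drop 1) rs)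
concat-↭-heads++tails []              = ↭.refl
concat-↭-heads++tails ([] ∷ rs)       = concat-↭-heads++tails rs
concat-↭-heads++tails ((x ∷ xs) ∷ rs) =
  ↭.prep x (↭.trans (++⁺ˡ xs (concat-↭-heads++tails rs)) (shifts xs (heads rs)))

cell : ℕ → List ℕ → Maybe (ℕ × Maybe ℕ)
cell c r = cellAt r c

column≡mapMaybe : ∀ T c → column T c ≡ mapMaybe (cell c) T
column≡mapMaybe []       c = refl
column≡mapMaybe (r ∷ rs) c with cellAt r c
... | just u  = cong (u ∷_) (column≡mapMaybe rs c)
... | nothing = column≡mapMaybe rs c

cellAt-drop₁ : ∀ r c → cellAt (drop 1 r) c ≡ cellAt r (suc c)
cellAt-drop₁ []           c = refl
cellAt-drop₁ (x ∷ [])     c = refl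
cellAt-drop₁ (x ∷ y ∷ ys) c = refl

column-drop₁ : ∀ T c → column (map (drop 1) T) c ≡ column T (suc c)
column-drop₁ T c = begin
  column (map (drop 1) T) c             ≡⟨ column≡mapMaybe (map (drop 1) T) c ⟩
  mapMaybe (cell c) (map (drop 1) T)    ≡⟨ mapMaybe-map (cell c) (drop 1) T ⟩
  mapMaybe (cell c ∘ drop 1) T          ≡⟨ mapMaybe-cong (λ r → cellAt-drop₁ r c) T ⟩
  mapMaybe (cell (suc c)) T             ≡⟨ column≡mapMaybe T (suc c) ⟨
  column T (suc c)                      ∎
  where open ≡-Reasoning

DecreasingRows : ∀ {A : Set} → List (List A) → Set
DecreasingRows = AllPairs (λ r r′ → length r′ ≤ length r)

DecreasingRows-drop₁ : ∀ {A : Set} {W : List (List A)} → DecreasingRows W → DecreasingRows (map (drop 1) W)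
DecreasingRows-drop₁ =
  AllPairs.map⁺ ∘
  AllPairs.map (λ {w} {w′} → subst₂ _≤_ (sym (length-drop 1 w′)) (sym (length-drop 1 w)) ∘ ∸-monoˡ-≤ 1)

Maximal : Tableau → Set
Maximal T = All (Linked _<_) T × (∀ c → AllInverted (column T c))

Maximal-drop₁ : ∀ {T} → Maximal T → Maximal (map (drop 1) T)
Maximal-drop₁ {T} (rows , cols) =
  All.map⁺ (All.map Linked-drop₁ rows) , λ c → subst AllInverted (sym (column-drop₁ T c)) (cols (suc c))
  where
  Linked-drop₁ : ∀ {r} → Linked _<_ r → Linked _<_ (drop 1 r)
  Linked-drop₁ []  = []
  Linked-drop₁ [-] = []
  Linked-drop₁ (_ ∷ row) = row

HeadBelowTail : List ℕ → List ℕ → Set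
HeadBelowTail r r′ = ∀ {x} → head r ≡ just x → All (x <_) (drop 1 r′)

below-row : ∀ {x y ys} → x < y → Linked _<_ (y ∷ ys) → All (x <_) (y ∷ ys)
below-row = Linked.Linked⇒All <-trans

head-below-own-tail : ∀ {r} → Linked _<_ r → HeadBelowTail r r
head-below-own-tail {x ∷ []}     _   refl = []
head-below-own-tail {x ∷ y ∷ ys} row refl = below-row (Linked.head row) (Linked.tail row)

-- Inversion of the two first-column cells orders their right neighbours oppositely to them, so each
-- first entry lies below the second entry of the other row.
head-below-tail : ∀ {r r′} → Linked _<_ r × Linked _<_ r′ → length r′ ≤ length r →
                  (Inverted on-just cell 0) r r′ →
                  HeadBelowTail r r′ × HeadBelowTail r′ r
head-below-tail {[]}         {r′}          _            _ _   = (λ ()) , (λ _ → [])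
head-below-tail {x ∷ xs}     {[]}          _            _ _   = (λ _ → []) , (λ ())
head-below-tail {x ∷ []}     {x′ ∷ []}     _            _ _   = (λ _ → []) , (λ _ → [])
head-below-tail {x ∷ []}     {x′ ∷ y′ ∷ _} _            (s≤s ()) _
head-below-tail {x ∷ y ∷ ys} {x′ ∷ []}     (row , _)    _ inv =
  (λ _ → []) , λ { refl → below-row (<-trans (<ᵇ≡true⇒< (inv _ _ refl refl)) (Linked.head row)) (Linked.tail row) }
head-below-tail {x ∷ y ∷ ys} {x′ ∷ y′ ∷ ys′} (row , row′) _ inv = upper , lower
  where
  x<x′⇔y′<y = Inverted-⇔ (inv _ _ refl refl)
  upper : HeadBelowTail (x ∷ y ∷ ys) (x′ ∷ y′ ∷ ys′)
  upper refl with x <? x′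
  ... | yes x<x′ = below-row (<-trans x<x′ (Linked.head row′)) (Linked.tail row′)
  ... | no  x≮x′ =
    below-row (<-≤-trans (Linked.head row) (≮⇒≥ (x≮x′ ∘ from x<x′⇔y′<y))) (Linked.tail row′)
  lower : HeadBelowTail (x′ ∷ y′ ∷ ys′) (x ∷ y ∷ ys)
  lower refl with x <? x′
  ... | yes x<x′ = below-row (<-trans (Linked.head row′) (to x<x′⇔y′<y x<x′)) (Linked.tail row)
  ... | no  x≮x′ = below-row (≤-<-trans (≮⇒≥ x≮x′) (Linked.head row)) (Linked.tail row)

heads-below-tails : ∀ {T} → DecreasingRows T → Maximal T → All (λ x → All (x <_) (concat (map (drop 1) T))) (heads T)
heads-below-tails {T} shape (rows , cols) =
  All-mapMaybe⁺ head (All.map (λ below {_} hx → All.concat⁺ (All.map⁺ (All.map (λ hbt → hbt hx) below)))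
                              (AllPairs-sym⇒All-All pairs (All.map head-below-own-tail rows)))
  where
  inverted : AllPairs (Inverted on-just cell 0) T
  inverted = AllPairs-mapMaybe⁻ (cell 0) (subst AllInverted (column≡mapMaybe T 0) (cols 0))
  pairs : AllPairs (λ r r′ → HeadBelowTail r r′ × HeadBelowTail r′ r) T
  pairs = AllPairs.zipWith (λ ((rows , shape) , inv) → head-below-tail rows shape inv)
                           (AllPairs.zip (AllPairs-of-All rows , shape) , inverted)

-- Uniqueness

Concordant : ℕ × ℕ → ℕ × ℕ → Set
Concordant (a , b) (a′ , b′) = (a < a′ ⇔ b < b′) × (a′ < a ⇔ b′ < b)

Concordant-sym : ∀ {p q} → Concordant p q → Concordant q p
Concordant-sym (lt , gt) = gt , lt

Apart : ℕ × ℕ → ℕ × ℕ → Set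
Apart p q = proj₁ p ≢ proj₁ q × proj₂ p ≢ proj₂ q

Apart-sym : ∀ {p q} → Apart p q → Apart q p
Apart-sym (a≢a′ , b≢b′) = a≢a′ ∘ sym , b≢b′ ∘ sym

_≺_ : ℕ × ℕ → ℕ × ℕ → Set
p ≺ q = proj₁ p < proj₁ q × proj₂ p < proj₂ q

≺⇒Concordant : ∀ {p q} → p ≺ q → Concordant p q
≺⇒Concordant {_ , _} {_ , _} (a<a′ , b<b′) =
  mk⇔ (λ _ → b<b′) (λ _ → a<a′) ,
  mk⇔ (λ a′<a → contradiction a<a′ (<-asym a′<a)) (λ b′<b → contradiction b<b′ (<-asym b′<b))

lower⇒Concordant : ∀ {a b a′ b′} → (a′ <ᵇ a) ≡ true → (b′ <ᵇ b) ≡ true → Concordant (a , b) (a′ , b′)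
lower⇒Concordant a′<a b′<b = Concordant-sym (≺⇒Concordant (<ᵇ≡true⇒< a′<a , <ᵇ≡true⇒< b′<b))

Apart⇒Concordant : ∀ {a b a′ b′} → Apart (a , b) (a′ , b′) → (a < a′ ⇔ b < b′) → Concordant (a , b) (a′ , b′)
Apart⇒Concordant (a≢a′ , b≢b′) a<a′⇔b<b′ =
  a<a′⇔b<b′ , mk⇔ (reversed b≢b′ (from a<a′⇔b<b′)) (reversed a≢a′ (to a<a′⇔b<b′))
  where
  reversed : ∀ {m m′ n n′} → n ≢ n′ → (n < n′ → m < m′) → m′ < m → n′ < n
  reversed n≢n′ n<n′⇒m<m′ m′<m = ≤∧≢⇒< (≮⇒≥ (<-asym m′<m ∘ n<n′⇒m<m′)) (n≢n′ ∘ sym)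

map² : ∀ {A B : Set} → (A → B) → List (List A) → List (List B)
map² f = map (map f)

heads-map² : ∀ {A B : Set} (f : A → B) W → heads (map² f W) ≡ map f (heads W)
heads-map² f []            = refl
heads-map² f ([] ∷ W)      = heads-map² f W
heads-map² f ((x ∷ w) ∷ W) = cong (f x ∷_) (heads-map² f W)

map²-drop₁ : ∀ {A B : Set} (f : A → B) W → map² f (map (drop 1) W) ≡ map (drop 1) (map² f W)
map²-drop₁ f []      = refl
map²-drop₁ f (w ∷ W) = cong₂ _∷_ (sym (drop-map 1 w)) (map²-drop₁ f W)

tails-map² : ∀ {A B : Set} (f : A → B) W → concat (map (drop 1) (map² f W)) ≡ map f (concat (map (drop 1) W))
tails-map² f W = trans (cong concat (sym (map²-drop₁ f W))) (concat-map (map (drop 1) W))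

DecreasingRows-map² : ∀ {A B : Set} (f : A → B) {W} → DecreasingRows W → DecreasingRows (map² f W)
DecreasingRows-map² f =
  AllPairs.map⁺ ∘ AllPairs.map (λ {w} {w′} → subst₂ _≤_ (sym (length-map f w′)) (sym (length-map f w)))

-- If both rows continue, a < a′ ⇔ c′ < c ⇔ d′ < d ⇔ b < b′; otherwise the lower first cell is smaller
-- in both tableaux.
head-concordant : ∀ {w w′ : List (ℕ × ℕ)} →
  (Inverted on-just (cell 0 ∘ map proj₁)) w w′ → (Inverted on-just (cell 0 ∘ map proj₂)) w w′ →
  (Apart on-just head) w w′ → (Concordant on-just (head ∘ drop 1)) w w′ → (Concordant on-just head) w w′
head-concordant {[]}              {_}          _ _ _ _ _ _ ()
head-concordant {_ ∷ _}           {[]}         _ _ _ _ _ _ _ ()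
head-concordant {_ ∷ []}          {_ ∷ []}     inv₁ inv₂ _ _ _ _ refl refl =
  lower⇒Concordant (inv₁ _ _ refl refl) (inv₂ _ _ refl refl)
head-concordant {_ ∷ []}          {_ ∷ _ ∷ _}  inv₁ inv₂ _ _ _ _ refl refl =
  lower⇒Concordant (inv₁ _ _ refl refl) (inv₂ _ _ refl refl)
head-concordant {_ ∷ _ ∷ _}       {_ ∷ []}     inv₁ inv₂ _ _ _ _ refl refl =
  lower⇒Concordant (inv₁ _ _ refl refl) (inv₂ _ _ refl refl)
head-concordant {(a , b) ∷ (c , d) ∷ _} {(a′ , b′) ∷ (c′ , d′) ∷ _} inv₁ inv₂ apart next _ _ refl refl =
  Apart⇒Concordant (apart _ _ refl refl)
    (⇔.trans (Inverted-⇔ (inv₁ _ _ refl refl))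
             (⇔.trans (proj₂ (next _ _ refl refl)) (⇔.sym (Inverted-⇔ (inv₂ _ _ refl refl)))))

heads-concordant : ∀ W → Maximal (map² proj₁ W) → Maximal (map² proj₂ W) → AllPairs Apart (heads W) →
                   AllPairs Concordant (heads (map (drop 1) W)) → AllPairs Concordant (heads W)
heads-concordant W (_ , cols₁) (_ , cols₂) apart next =
  AllPairs-mapMaybe⁺ head
    (AllPairs.map (λ (((inv₁ , inv₂) , apart) , next) → head-concordant inv₁ inv₂ apart next)
      (AllPairs.zip (AllPairs.zip (AllPairs.zip (inverted proj₁ (cols₁ 0) , inverted proj₂ (cols₂ 0)) ,
                                   apart-heads) ,
                     next-heads)))
  where
  inverted : ∀ π → AllInverted (column (map² π W) 0) → AllPairs (Inverted on-just (cell 0 ∘ map π)) W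
  inverted π col = AllPairs-mapMaybe⁻ (cell 0 ∘ map π)
    (subst AllInverted (trans (column≡mapMaybe (map² π W) 0) (mapMaybe-map (cell 0) (map π) W)) col)
  apart-heads : AllPairs (Apart on-just head) W
  apart-heads = AllPairs-mapMaybe⁻ head apart
  next-heads : AllPairs (Concordant on-just (head ∘ drop 1)) W
  next-heads = AllPairs-mapMaybe⁻ (head ∘ drop 1) (subst (AllPairs Concordant) (mapMaybe-map head (drop 1) W) next)

heads-≺-tails : ∀ W → DecreasingRows W → Maximal (map² proj₁ W) → Maximal (map² proj₂ W) →
                All (λ h → All (h ≺_) (concat (map (drop 1) W))) (heads W)
heads-≺-tails W shape max₁ max₂ = All.zipWith (All.zipWith id) (below proj₁ max₁ , below proj₂ max₂)
  where
  below : ∀ π → Maximal (map² π W) → All (λ h → All (λ e → π h < π e) (concat (map (drop 1) W))) (heads W)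
  below π max =
    All.map All.map⁻ (All.map⁻ (subst₂ (λ H E → All (λ x → All (x <_) E) H) (heads-map² π W) (tails-map² π W)
      (heads-below-tails (DecreasingRows-map² π shape) max)))

concat-empty : ∀ {A : Set} {W : List (List A)} → All (λ w → length w ≤ 0) W → concat W ≡ []
concat-empty {W = []}      []      = refl
concat-empty {W = [] ∷ W} (_ ∷ s) = concat-empty s

-- W pairs the entries of two tableaux cell by cell; n bounds the row lengths and decreases as the
-- first column is peeled off.
zipped-concordant : ∀ n W → All (λ w → length w ≤ n) W → DecreasingRows W →
                    Maximal (map² proj₁ W) → Maximal (map² proj₂ W) →
                    AllPairs Apart (concat W) → AllPairs Concordant (concat W)
zipped-concordant zero    W short _ _ _ _ = subst (AllPairs Concordant) (sym (concat-empty short)) []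
zipped-concordant (suc n) W short shape max₁ max₂ apart =
  AllPairs-resp-↭ Concordant-sym (↭-sym (concat-↭-heads++tails W))
    (AllPairs.++⁺ concordant-heads concordant-tails
                  (All.map (All.map ≺⇒Concordant) (heads-≺-tails W shape max₁ max₂)))
  where
  W′ = map (drop 1) W
  apart-split = AllPairs-++⁻ (heads W) (AllPairs-resp-↭ Apart-sym (concat-↭-heads++tails W) apart)
  Maximal-W′ : ∀ π → Maximal (map² π W) → Maximal (map² π W′)
  Maximal-W′ π = subst Maximal (sym (map²-drop₁ π W)) ∘ Maximal-drop₁
  concordant-tails : AllPairs Concordant (concat W′)
  concordant-tails =
    zipped-concordant n W′
      (All.map⁺ (All.map (λ {w} ≤1+n → subst (_≤ n) (sym (length-drop 1 w)) (∸-monoˡ-≤ 1 ≤1+n)) short))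
      (DecreasingRows-drop₁ shape) (Maximal-W′ proj₁ max₁) (Maximal-W′ proj₂ max₂) (proj₂ apart-split)
  concordant-heads : AllPairs Concordant (heads W)
  concordant-heads = heads-concordant W max₁ max₂ (proj₁ apart-split)
    (proj₁ (AllPairs-++⁻ (heads W′) (AllPairs-resp-↭ Concordant-sym (concat-↭-heads++tails W′) concordant-tails)))

rank : ℕ → List ℕ → ℕ
rank a = count (_<ᵇ a)

indicator-mono : ∀ {a b} x → a ≤ b → (if x <ᵇ a then 1 else 0) ≤ (if x <ᵇ b then 1 else 0)
indicator-mono {a} {b} x a≤b with x <ᵇ a in x<ᵇa
... | false = z≤n
... | true rewrite <⇒<ᵇ≡true (<-≤-trans (<ᵇ≡true⇒< x<ᵇa) a≤b) = ≤-refl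

rank-mono-≤ : ∀ {a b} xs → a ≤ b → rank a xs ≤ rank b xs
rank-mono-≤ []       a≤b = z≤n
rank-mono-≤ (x ∷ xs) a≤b = +-mono-≤ (indicator-mono x a≤b) (rank-mono-≤ xs a≤b)

rank-< : ∀ {a b xs} → a < b → a ∈ xs → rank a xs < rank b xs
rank-< {a} {b} {_ ∷ xs} a<b (here refl)
  rewrite ≥⇒<ᵇ≡false {a} {a} ≤-refl | <⇒<ᵇ≡true a<b = s≤s (rank-mono-≤ xs (<⇒≤ a<b))
rank-< {xs = x ∷ _} a<b (there a∈xs) = +-mono-≤-< (indicator-mono x (<⇒≤ a<b)) (rank-< a<b a∈xs)

SameSide : ℕ × ℕ → ℕ × ℕ → Set
SameSide z w = (proj₁ w <ᵇ proj₁ z) ≡ (proj₂ w <ᵇ proj₂ z)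

SameSide-refl : ∀ z → SameSide z z
SameSide-refl (a , b) = trans (≥⇒<ᵇ≡false {a} ≤-refl) (sym (≥⇒<ᵇ≡false {b} ≤-refl))

Concordant⇒SameSide : ∀ {z w} → Concordant z w → SameSide z w × SameSide w z
Concordant⇒SameSide {_ , _} {_ , _} (lt , gt) = ⇔⇒<ᵇ≡ gt , ⇔⇒<ᵇ≡ lt

rank-concordant : ∀ {zs z} → AllPairs Concordant zs → z ∈ zs →
                  rank (proj₁ z) (map proj₁ zs) ≡ rank (proj₂ z) (map proj₂ zs)
rank-concordant {zs} {z} concordant z∈zs =
  count-map-cong _ _ proj₁ proj₂
    (All.lookup (AllPairs-sym⇒All-All (AllPairs.map Concordant⇒SameSide concordant)
                                      (All.tabulate λ {z} _ → SameSide-refl z))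
                z∈zs)

-- An entry of a repetition-free list is determined by its rank, and concordance makes the ranks agree.
concordant-↭⇒proj₁≡proj₂ : ∀ {zs} → AllPairs Concordant zs → map proj₁ zs ↭ map proj₂ zs →
                           All (λ z → proj₁ z ≡ proj₂ z) zs
concordant-↭⇒proj₁≡proj₂ {zs} concordant perm = All.tabulate same
  where
  same : ∀ {z} → z ∈ zs → proj₁ z ≡ proj₂ z
  same {a , b} z∈zs with <-cmp a b
  ... | tri≈ _ a≡b _ = a≡b
  ... | tri< a<b _ _ = contradiction (begin-strict
          rank a (map proj₁ zs) <⟨ rank-< a<b (∈-map⁺ proj₁ z∈zs) ⟩
          rank b (map proj₁ zs) ≡⟨ count-↭ _ perm ⟩
          rank b (map proj₂ zs) ≡⟨ rank-concordant concordant z∈zs ⟨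
          rank a (map proj₁ zs) ∎) (<-irrefl refl)
    where open ≤-Reasoning
  ... | tri> _ _ b<a = contradiction (begin-strict
          rank b (map proj₂ zs) <⟨ rank-< b<a (∈-map⁺ proj₂ z∈zs) ⟩
          rank a (map proj₂ zs) ≡⟨ count-↭ _ perm ⟨
          rank a (map proj₁ zs) ≡⟨ rank-concordant concordant z∈zs ⟩
          rank b (map proj₂ zs) ∎) (<-irrefl refl)
    where open ≤-Reasoning

unzip-row : ∀ (r s : List ℕ) → length r ≡ length s → map proj₁ (zip r s) ≡ r × map proj₂ (zip r s) ≡ s
unzip-row []      []      _  = refl , refl
unzip-row (x ∷ r) (y ∷ s) eq =
  let r≡ , s≡ = unzip-row r s (suc-injective eq) in cong (x ∷_) r≡ , cong (y ∷_) s≡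

unzip-rows : ∀ (T U : Tableau) → map length T ≡ map length U →
             map² proj₁ (zipWith zip T U) ≡ T × map² proj₂ (zipWith zip T U) ≡ U
unzip-rows []      []      _  = refl , refl
unzip-rows (r ∷ T) (s ∷ U) eq =
  let r≈s , T≈U = ∷-injective eq
      r≡ , s≡   = unzip-row r s r≈s
      T≡ , U≡   = unzip-rows T U T≈U
  in cong₂ _∷_ r≡ T≡ , cong₂ _∷_ s≡ U≡

map-length-map² : ∀ {A B : Set} (f : A → B) W → map length (map² f W) ≡ map length W
map-length-map² f W = trans (sym (map-∘ W)) (map-cong (length-map f) W)

entries-distinct : ∀ {la T} → IsRowStandard la T → AllPairs _≢_ (concat T)
entries-distinct (_ , perm , _) =
  AllPairs-resp-↭ (_∘ sym) (↭-sym perm)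
    (AllPairs.map⁺ (AllPairs.applyUpTo⁺₁ id _ (λ i<j _ → <⇒≢ i<j ∘ suc-injective)))

Maximal-unique : ∀ {la T U} → Linked _≥_ la → IsRowStandard la T → IsRowStandard la U →
                 Maximal T → Maximal U → T ≡ U
Maximal-unique {la} {T} {U} decreasing rsT@(shapeT , permT , _) rsU@(shapeU , permU , _) maxT maxU = begin
  T              ≡⟨ T≡ ⟨
  map² proj₁ W   ≡⟨ map-cong-local (All.map map-cong-local
                                             (All.concat⁻ (concordant-↭⇒proj₁≡proj₂ concordant perm))) ⟩
  map² proj₂ W   ≡⟨ U≡ ⟩
  U              ∎
  where
  open ≡-Reasoning
  W = zipWith zip T U
  unzipped = unzip-rows T U (trans shapeT (sym shapeU))
  T≡ = proj₁ unzipped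
  U≡ = proj₂ unzipped
  shapeW : map length W ≡ la
  shapeW = trans (sym (map-length-map² proj₁ W)) (trans (cong (map length) T≡) shapeT)
  entries : ∀ π {V} → map² π W ≡ V → concat V ≡ map π (concat W)
  entries π refl = concat-map W
  perm : map proj₁ (concat W) ↭ map proj₂ (concat W)
  perm = subst₂ _↭_ (entries proj₁ T≡) (entries proj₂ U≡) (↭.trans permT (↭-sym permU))
  apart : AllPairs Apart (concat W)
  apart = AllPairs.zip (AllPairs.map⁻ (subst (AllPairs _≢_) (entries proj₁ T≡) (entries-distinct rsT)) ,
                        AllPairs.map⁻ (subst (AllPairs _≢_) (entries proj₂ U≡) (entries-distinct rsU)))
  concordant : AllPairs Concordant (concat W)
  concordant = zipped-concordant (width la) W
    (All.map⁻ (subst (All (_≤ width la)) (sym shapeW) (parts≤width la)))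
    (AllPairs.map⁻ (subst (AllPairs _≥_) (sym shapeW) (Linked.Linked⇒AllPairs (flip ≤-trans) decreasing)))
    (subst Maximal (sym T≡) maxT) (subst Maximal (sym U≡) maxU) apart

-- Existence

range : ℕ → ℕ → List ℕ
range a zero    = []
range a (suc n) = a ∷ range (suc a) n

range-bounds : ∀ a n → All (λ x → a ≤ x × x < a + n) (range a n)
range-bounds a zero    = []
range-bounds a (suc n) =
  (≤-refl , m<m+n a z<s) ∷
  All.map (λ {x} (a<x , x<) → <⇒≤ a<x , subst (x <_) (sym (+-suc a n)) x<) (range-bounds (suc a) n)

range-increasing : ∀ a n → AllPairs _<_ (range a n)
range-increasing a zero    = []
range-increasing a (suc n) = All.map proj₁ (range-bounds (suc a) n) ∷ range-increasing (suc a) n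

range-++ : ∀ a m n → range a m ++ range (a + m) n ≡ range a (m + n)
range-++ a zero    n = cong (λ b → range b n) (+-identityʳ a)
range-++ a (suc m) n =
  cong (a ∷_) (trans (cong (λ b → range (suc a) m ++ range b n) (+-suc a m)) (range-++ (suc a) m n))

range-snoc : ∀ a n → range a (suc n) ≡ range a n ++ [ a + n ]
range-snoc a n = trans (cong (range a) (+-comm 1 n)) (sym (range-++ a n 1))

applyUpTo≡range : ∀ (f : ℕ → ℕ) a n → (∀ i → f i ≡ a + i) → applyUpTo f n ≡ range a n
applyUpTo≡range f a zero    _      = refl
applyUpTo≡range f a (suc n) f≡a+ =
  cong₂ _∷_ (trans (f≡a+ 0) (+-identityʳ a))
            (applyUpTo≡range (f ∘ suc) (suc a) n (λ i → trans (f≡a+ (suc i)) (+-suc a i)))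

map-suc-upTo : ∀ n → map suc (upTo n) ≡ range 1 n
map-suc-upTo n = trans (map-applyUpTo (λ i → i) suc n) (applyUpTo≡range suc 1 n (λ _ → refl))

map-∸-range : ∀ c a n → a + n ≤ suc c → map (c ∸_) (range a n) ↭ range (suc c ∸ (a + n)) n
map-∸-range c a zero    _         = ↭.refl
map-∸-range c a (suc n) a+1+n≤1+c rewrite +-suc a n = begin
  map (c ∸_) (range a (suc n))           ≡⟨ cong (map (c ∸_)) (range-snoc a n) ⟩
  map (c ∸_) (range a n ++ [ a + n ])    ≡⟨ map-++ (c ∸_) (range a n) [ a + n ] ⟩
  map (c ∸_) (range a n) ++ [ b ]        ↭⟨ ++-comm (map (c ∸_) (range a n)) [ b ] ⟩
  b ∷ map (c ∸_) (range a n)             ↭⟨ ↭.prep b (map-∸-range c a n (m≤n⇒m≤1+n a+n≤c)) ⟩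
  b ∷ range (suc c ∸ (a + n)) n          ≡⟨ cong (λ x → b ∷ range x n) (+-∸-assoc 1 a+n≤c) ⟩
  b ∷ range (suc b) n                    ∎
  where
  open PermutationReasoning
  a+n≤c = ≤-pred a+1+n≤1+c
  b = c ∸ (a + n)

nonzeroParts : List ℕ → ℕ
nonzeroParts []           = 0
nonzeroParts (zero ∷ la)  = nonzeroParts la
nonzeroParts (suc _ ∷ la) = suc (nonzeroParts la)

nonzeroParts-pred : ∀ {la} → All (_≤ 1) la → nonzeroParts (map pred la) ≡ 0
nonzeroParts-pred                    []           = refl
nonzeroParts-pred {zero ∷ _}         (_ ∷ ≤1)     = nonzeroParts-pred ≤1
nonzeroParts-pred {suc zero ∷ _}     (_ ∷ ≤1)     = nonzeroParts-pred ≤1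
nonzeroParts-pred {suc (suc _) ∷ _}  (s≤s () ∷ _)

nonzeroParts-pred-≤ : ∀ la → nonzeroParts (map pred la) ≤ nonzeroParts la
nonzeroParts-pred-≤ []                 = z≤n
nonzeroParts-pred-≤ (zero ∷ la)        = nonzeroParts-pred-≤ la
nonzeroParts-pred-≤ (suc zero ∷ la)    = m≤n⇒m≤1+n (nonzeroParts-pred-≤ la)
nonzeroParts-pred-≤ (suc (suc _) ∷ la) = s≤s (nonzeroParts-pred-≤ la)

sum≡nonzeroParts+sum-pred : ∀ la → sum la ≡ nonzeroParts la + sum (map pred la)
sum≡nonzeroParts+sum-pred []          = refl
sum≡nonzeroParts+sum-pred (zero ∷ la) = sum≡nonzeroParts+sum-pred la
sum≡nonzeroParts+sum-pred (suc l ∷ la) =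
  cong suc (trans (cong (l +_) (sum≡nonzeroParts+sum-pred la)) (x∙yz≈y∙xz l (nonzeroParts la) _))

-- maximalTableau n la K₀ has shape la (all parts ≤ n) and entries K₀+1, …, K₀+|la|; its first column
-- receives K₀+1, …, K₀+h = K.  A row continuing with y starts with 2K+1−y, which reverses the order
-- of the second column, and the i-th nonempty row, if it has length one, starts with K−i.
firstEntry : ℕ → ℕ → List ℕ → ℕ
firstEntry K i []      = K ∸ i
firstEntry K i (y ∷ _) = suc (K + K) ∸ y

prependColumn : ℕ → ℕ → List ℕ → Tableau → Tableau
prependColumn K i []           _        = []
prependColumn K i (_ ∷ _)      []       = []
prependColumn K i (zero ∷ la)  (t ∷ ts) = [] ∷ prependColumn K i la ts
prependColumn K i (suc _ ∷ la) (t ∷ ts) = (firstEntry K i t ∷ t) ∷ prependColumn K (suc i) la ts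

maximalTableau : ℕ → List ℕ → ℕ → Tableau
maximalTableau zero    la K₀ = map (λ _ → []) la
maximalTableau (suc n) la K₀ = prependColumn K 0 la (maximalTableau n (map pred la) K)
  where K = K₀ + nonzeroParts la

paired : ℕ → ℕ → ℕ × Maybe ℕ
paired K y = suc (K + K) ∸ y , just y

lonely : ℕ → ℕ → ℕ × Maybe ℕ
lonely K j = K ∸ j , nothing

heads-empty-rows : ∀ {la} (T′ : Tableau) → All (_≤ 1) la → map length T′ ≡ map pred la → heads T′ ≡ []
heads-empty-rows                    []        []           _ = refl
heads-empty-rows {zero ∷ _}         ([] ∷ T′) (_ ∷ ≤1)     e = heads-empty-rows T′ ≤1 (∷-injectiveʳ e)
heads-empty-rows {suc zero ∷ _}     ([] ∷ T′) (_ ∷ ≤1)     e = heads-empty-rows T′ ≤1 (∷-injectiveʳ e)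
heads-empty-rows {suc (suc _) ∷ _}  _         (s≤s () ∷ _) _

parts≤1 : ∀ {x la} → Linked _≥_ (x ∷ la) → x ≤ 1 → All (_≤ 1) (x ∷ la)
parts≤1 dec x≤1 = All.map (λ ≤x → ≤-trans ≤x x≤1) (Linked.Linked⇒All (flip ≤-trans) ≤-refl dec)

module _ (K : ℕ) where

  shape-prependColumn : ∀ i la T′ → map length T′ ≡ map pred la → map length (prependColumn K i la T′) ≡ la
  shape-prependColumn i []           []       _ = refl
  shape-prependColumn i (zero ∷ la)  (t ∷ T′) e = cong (0 ∷_) (shape-prependColumn i la T′ (∷-injectiveʳ e))
  shape-prependColumn i (suc _ ∷ la) (t ∷ T′) e =
    cong₂ _∷_ (cong suc (∷-injectiveˡ e)) (shape-prependColumn (suc i) la T′ (∷-injectiveʳ e))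

  drop₁-prependColumn : ∀ i la T′ → map length T′ ≡ map pred la → map (drop 1) (prependColumn K i la T′) ≡ T′
  drop₁-prependColumn i []           []        _ = refl
  drop₁-prependColumn i (zero ∷ la)  ([] ∷ T′) e = cong ([] ∷_) (drop₁-prependColumn i la T′ (∷-injectiveʳ e))
  drop₁-prependColumn i (suc _ ∷ la) (t ∷ T′)  e = cong (t ∷_) (drop₁-prependColumn (suc i) la T′ (∷-injectiveʳ e))

  rows-prependColumn : ∀ i la T′ → map length T′ ≡ map pred la → All (Linked _<_) T′ → All (K <_) (heads T′) →
                       All (Linked _<_) (prependColumn K i la T′)
  rows-prependColumn i []           []               _ _            _             = []
  rows-prependColumn i (zero ∷ la)  ([] ∷ T′)        e (_ ∷ rows)   above         =
    [] ∷ rows-prependColumn i la T′ (∷-injectiveʳ e) rows above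
  rows-prependColumn i (suc _ ∷ la) ([] ∷ T′)        e (_ ∷ rows)   above         =
    [-] ∷ rows-prependColumn (suc i) la T′ (∷-injectiveʳ e) rows above
  rows-prependColumn i (suc _ ∷ la) ((y ∷ ys) ∷ T′) e (row ∷ rows) (K<y ∷ above) =
    (reflected<y ∷ row) ∷ rows-prependColumn (suc i) la T′ (∷-injectiveʳ e) rows above
    where
    reflected<y : suc (K + K) ∸ y < y
    reflected<y = ≤-<-trans (≤-trans (∸-monoʳ-≤ (suc (K + K)) K<y) (≤-reflexive (m+n∸n≡m K K))) K<y

  lonely-column : ∀ i la T′ → All (_≤ 1) la → map length T′ ≡ map pred la →
                  column (prependColumn K i la T′) 0 ≡ map (lonely K) (range i (nonzeroParts la))
  lonely-column i []              []        _          _ = refl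
  lonely-column i (zero ∷ la)     ([] ∷ T′) (_ ∷ ≤1)   e = lonely-column i la T′ ≤1 (∷-injectiveʳ e)
  lonely-column i (suc zero ∷ la) ([] ∷ T′) (_ ∷ ≤1)   e =
    cong (lonely K i ∷_) (lonely-column (suc i) la T′ ≤1 (∷-injectiveʳ e))
  lonely-column i (suc (suc _) ∷ la) _      (s≤s () ∷ _) _

  column₀-prependColumn-≤1 : ∀ i la T′ → All (_≤ 1) la → map length T′ ≡ map pred la →
    column (prependColumn K i la T′) 0 ≡
      map (paired K) (heads T′) ++
      map (lonely K) (range (i + nonzeroParts (map pred la)) (nonzeroParts la ∸ nonzeroParts (map pred la)))
  column₀-prependColumn-≤1 i la T′ ≤1 e rewrite nonzeroParts-pred ≤1 | +-identityʳ i =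
    trans (lonely-column i la T′ ≤1 e) (cong (λ H → map (paired K) H ++ _) (sym (heads-empty-rows T′ ≤1 e)))

  column₀-prependColumn : ∀ i la T′ → Linked _≥_ la → map length T′ ≡ map pred la →
    column (prependColumn K i la T′) 0 ≡
      map (paired K) (heads T′) ++
      map (lonely K) (range (i + nonzeroParts (map pred la)) (nonzeroParts la ∸ nonzeroParts (map pred la)))
  column₀-prependColumn i []                 []               _   _ = refl
  column₀-prependColumn i (suc (suc _) ∷ la) ((y ∷ _) ∷ T′)   dec e rewrite +-suc i (nonzeroParts (map pred la)) =
    cong (paired K y ∷_) (column₀-prependColumn (suc i) la T′ (Linked.tail dec) (∷-injectiveʳ e))
  column₀-prependColumn i la@(zero ∷ _)      T′ dec e = column₀-prependColumn-≤1 i la T′ (parts≤1 dec z≤n) e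
  column₀-prependColumn i la@(suc zero ∷ _)  T′ dec e = column₀-prependColumn-≤1 i la T′ (parts≤1 dec ≤-refl) e

module _ (K : ℕ) where

  paired-inverted : ∀ {y y′} → y ≤ suc (K + K) → y′ ≤ suc (K + K) → y ≢ y′ →
                    Inverted (paired K y) (paired K y′)
  paired-inverted {y} {y′} y≤ y′≤ y≢y′ with <-cmp y y′
  ... | tri≈ _ y≡y′ _ = contradiction y≡y′ y≢y′
  ... | tri< y<y′ _ _ rewrite ≥⇒<ᵇ≡false (<⇒≤ (∸-monoʳ-< y<y′ y′≤)) = <⇒<ᵇ≡true y<y′
  ... | tri> _ _ y′<y rewrite <⇒<ᵇ≡true (∸-monoʳ-< y′<y y≤)          = <⇒<ᵇ≡true y′<y

  lonely-inverted : ∀ {j j′} → j < j′ → j < K → Inverted (lonely K j) (lonely K j′)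
  lonely-inverted j<j′ j<K = <⇒<ᵇ≡true (≤-<-trans (∸-monoʳ-≤ K j<j′) (∸-monoʳ-< (n<1+n _) j<K))

  paired-lonely-inverted : ∀ {p y j} → y ≤ K + p → p ≤ K → p ≤ j → Inverted (paired K y) (lonely K j)
  paired-lonely-inverted {p} {y} {j} y≤K+p p≤K p≤j = <⇒<ᵇ≡true (begin-strict
    K ∸ j                  ≤⟨ ∸-monoʳ-≤ K p≤j ⟩
    K ∸ p                  <⟨ n<1+n (K ∸ p) ⟩
    suc (K ∸ p)            ≡⟨ +-∸-assoc 1 p≤K ⟨
    suc K ∸ p              ≡⟨ [m+n]∸[m+o]≡n∸o K (suc K) p ⟨
    K + suc K ∸ (K + p)    ≡⟨ cong (_∸ (K + p)) (+-suc K K) ⟩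
    suc (K + K) ∸ (K + p)  ≤⟨ ∸-monoʳ-≤ (suc (K + K)) y≤K+p ⟩
    suc (K + K) ∸ y        ∎)
    where open ≤-Reasoning

  column₀-inverted : ∀ p q {Y} → Y ↭ range (suc K) p → p + q ≤ K →
                     AllInverted (map (paired K) Y ++ map (lonely K) (range p q))
  column₀-inverted p q {Y} Y↭ p+q≤K =
    AllPairs.++⁺
      (AllPairs.map⁺ (AllPairs.map (λ ((b , b′) , y≢y′) → paired-inverted (below b) (below b′) y≢y′)
                                   (AllPairs.zip (AllPairs-of-All Y-bounds , Y-distinct))))
      (AllPairs.map⁺ (AllPairs.map (λ ((b , _) , j<j′) → lonely-inverted j<j′ (<-≤-trans (proj₂ b) p+q≤K))
                                   (AllPairs.zip (AllPairs-of-All (range-bounds p q) , range-increasing p q))))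
      (All.map⁺ (All.map (λ b → All.map⁺ (All.map (paired-lonely-inverted (≤-pred (proj₂ b)) p≤K ∘ proj₁)
                                                  (range-bounds p q)))
                         Y-bounds))
    where
    p≤K : p ≤ K
    p≤K = m+n≤o⇒m≤o p p+q≤K
    Y-bounds : All (λ y → suc K ≤ y × y < suc K + p) Y
    Y-bounds = All-resp-↭ (↭-sym Y↭) (range-bounds (suc K) p)
    Y-distinct : AllPairs _≢_ Y
    Y-distinct = AllPairs-resp-↭ (_∘ sym) (↭-sym Y↭) (AllPairs.map <⇒≢ (range-increasing (suc K) p))
    below : ∀ {y} → suc K ≤ y × y < suc K + p → y ≤ suc (K + K)
    below (_ , y<) = ≤-trans (≤-pred y<) (≤-trans (+-monoʳ-≤ K p≤K) (n≤1+n (K + K)))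

heads≡column₀ : ∀ T → heads T ≡ map proj₁ (column T 0)
heads≡column₀ []                = refl
heads≡column₀ ([] ∷ T)          = heads≡column₀ T
heads≡column₀ ((x ∷ []) ∷ T)    = cong (x ∷_) (heads≡column₀ T)
heads≡column₀ ((x ∷ _ ∷ _) ∷ T) = cong (x ∷_) (heads≡column₀ T)

reflected-ranges : ∀ K₀ q p {h} → q + p ≡ h → let K = K₀ + h in
  map (suc (K + K) ∸_) (range (suc K) p) ++ map (K ∸_) (range p q) ↭ range (suc K₀) h
reflected-ranges K₀ q p refl = begin
  map (suc (K + K) ∸_) (range (suc K) p) ++ map (K ∸_) (range p q)    ↭⟨ ++⁺ (map-∸-range (suc (K + K)) (suc K) p bound₁)
                                                                                (map-∸-range K p q bound₂) ⟩
  range (suc (K + K) ∸ (K + p)) p ++ range (suc K ∸ (p + q)) q        ≡⟨ cong₂ (λ a b → range a p ++ range b q) start₁ start₂ ⟩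
  range (suc K₀ + q) p ++ range (suc K₀) q                             ↭⟨ ++-comm (range (suc K₀ + q) p) (range (suc K₀) q) ⟩
  range (suc K₀) q ++ range (suc K₀ + q) p                             ≡⟨ range-++ (suc K₀) q p ⟩
  range (suc K₀) (q + p)                                               ∎
  where
  open PermutationReasoning
  K = K₀ + (q + p)
  p≤K : p ≤ K
  p≤K = ≤-trans (m≤n+m p q) (m≤n+m (q + p) K₀)
  bound₁ : suc K + p ≤ suc (suc (K + K))
  bound₁ = s≤s (≤-trans (+-monoʳ-≤ K p≤K) (n≤1+n (K + K)))
  bound₂ : p + q ≤ suc K
  bound₂ = ≤-trans (≤-reflexive (+-comm p q)) (≤-trans (m≤n+m (q + p) K₀) (n≤1+n K))
  start₁ : suc (K + K) ∸ (K + p) ≡ suc K₀ + q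
  start₁ = trans (cong (_∸ (K + p)) (sym (+-suc K K)))
          (trans ([m+n]∸[m+o]≡n∸o K (suc K) p)
          (trans (cong (λ n → suc n ∸ p) (sym (+-assoc K₀ q p))) (m+n∸n≡m (suc K₀ + q) p)))
  start₂ : suc K ∸ (p + q) ≡ suc K₀
  start₂ = trans (cong (suc K ∸_) (+-comm p q)) (m+n∸n≡m (suc K₀) (q + p))

MaximalFrom : ℕ → List ℕ → Tableau → Set
MaximalFrom K₀ la T =
  map length T ≡ la × Maximal T × concat T ↭ range (suc K₀) (sum la) × heads T ↭ range (suc K₀) (nonzeroParts la)

empty-maximal : ∀ K₀ {la} → All (_≤ 0) la → MaximalFrom K₀ la (map (λ _ → []) la)
empty-maximal K₀ [] = refl , ([] , λ _ → []) , ↭.refl , ↭.refl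
empty-maximal K₀ {zero ∷ _} (_ ∷ zeros) with empty-maximal K₀ zeros
... | shape , (rows , cols) , entries , heads = cong (0 ∷_) shape , ([] ∷ rows , cols) , entries , heads

heads-prependColumn-↭ : ∀ K₀ la T′ → Linked _≥_ la → map length T′ ≡ map pred la →
  let h = nonzeroParts la; p = nonzeroParts (map pred la); K = K₀ + h in
  heads T′ ↭ range (suc K) p → heads (prependColumn K 0 la T′) ↭ range (suc K₀) h
heads-prependColumn-↭ K₀ la T′ dec shape′ heads′ = begin
  heads T                                                               ≡⟨ heads≡column₀ T ⟩
  map proj₁ (column T 0)                                                ≡⟨ cong (map proj₁) (column₀-prependColumn K 0 la T′ dec shape′) ⟩
  map proj₁ (map (paired K) (heads T′) ++ map (lonely K) (range p q))   ≡⟨ map-++ proj₁ (map (paired K) (heads T′)) _ ⟩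
  map proj₁ (map (paired K) (heads T′)) ++ map proj₁ (map (lonely K) (range p q))
                                                                        ≡⟨ cong₂ _++_ (map-∘ (heads T′)) (map-∘ (range p q)) ⟨
  map (suc (K + K) ∸_) (heads T′) ++ map (K ∸_) (range p q)             ↭⟨ ++⁺ (map⁺ (suc (K + K) ∸_) heads′) ↭.refl ⟩
  map (suc (K + K) ∸_) (range (suc K) p) ++ map (K ∸_) (range p q)      ↭⟨ reflected-ranges K₀ q p (m∸n+n≡m (nonzeroParts-pred-≤ la)) ⟩
  range (suc K₀) h                                                      ∎
  where
  open PermutationReasoning
  h = nonzeroParts la
  p = nonzeroParts (map pred la)
  q = h ∸ p
  K = K₀ + h
  T = prependColumn K 0 la T′

prependColumn-maximal : ∀ K₀ la T′ → Linked _≥_ la → MaximalFrom (K₀ + nonzeroParts la) (map pred la) T′ →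
                        MaximalFrom K₀ la (prependColumn (K₀ + nonzeroParts la) 0 la T′)
prependColumn-maximal K₀ la T′ dec (shape′ , (rows′ , cols′) , entries′ , heads′) =
  shape-prependColumn K 0 la T′ shape′ , (rows , cols) , entries , heads↭
  where
  open PermutationReasoning
  h = nonzeroParts la
  p = nonzeroParts (map pred la)
  K = K₀ + h
  T = prependColumn K 0 la T′
  drop₁ = drop₁-prependColumn K 0 la T′ shape′
  heads↭ = heads-prependColumn-↭ K₀ la T′ dec shape′ heads′
  rows = rows-prependColumn K 0 la T′ shape′ rows′
           (All.map proj₁ (All-resp-↭ (↭-sym heads′) (range-bounds (suc K) p)))
  cols : ∀ c → AllInverted (column T c)
  cols zero    = subst AllInverted (sym (column₀-prependColumn K 0 la T′ dec shape′))
                   (column₀-inverted K p (h ∸ p) heads′ (≤-trans (≤-reflexive (m+[n∸m]≡n (nonzeroParts-pred-≤ la)))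
                                                                (m≤n+m h K₀)))
  cols (suc c) = subst AllInverted (trans (cong (λ V → column V c) (sym drop₁)) (column-drop₁ T c)) (cols′ c)
  entries : concat T ↭ range (suc K₀) (sum la)
  entries = begin
    concat T                                               ↭⟨ concat-↭-heads++tails T ⟩
    heads T ++ concat (map (drop 1) T)                     ≡⟨ cong (λ V → heads T ++ concat V) drop₁ ⟩
    heads T ++ concat T′                                   ↭⟨ ++⁺ heads↭ entries′ ⟩
    range (suc K₀) h ++ range (suc K) (sum (map pred la))  ≡⟨ range-++ (suc K₀) h _ ⟩
    range (suc K₀) (h + sum (map pred la))                 ≡⟨ cong (range (suc K₀)) (sum≡nonzeroParts+sum-pred la) ⟨
    range (suc K₀) (sum la)                                ∎

maximalTableau-maximal : ∀ n la K₀ → Linked _≥_ la → All (_≤ n) la →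
                         MaximalFrom K₀ la (maximalTableau n la K₀)
maximalTableau-maximal zero    la K₀ _   ≤0 = empty-maximal K₀ ≤0
maximalTableau-maximal (suc n) la K₀ dec ≤n =
  prependColumn-maximal K₀ la _ dec
    (maximalTableau-maximal n (map pred la) (K₀ + nonzeroParts la)
      (Linked.map⁺ (Linked.map pred-mono-≤ dec)) (All.map⁺ (All.map pred-mono-≤ ≤n)))

RowStandard⇒inversions≤M : ∀ {la T} → IsRowStandard la T → inversions T ≤ M la
RowStandard⇒inversions≤M {T = T} (refl , _) = inversions-≤-M T

inversions≡M⇒Maximal : ∀ {la T} → IsRowStandard la T → inversions T ≡ M la → Maximal T
inversions≡M⇒Maximal {T = T} (refl , _ , rows) eq = rows , inversions≡M⇒AllInverted T eq

Maximal⇒inversions≡M : ∀ {la T} → IsRowStandard la T → Maximal T → inversions T ≡ M la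
Maximal⇒inversions≡M {T = T} (refl , _) (_ , cols) = AllInverted⇒inversions≡M T cols

MaximalFrom⇒IsRowStandard : ∀ {la T} → MaximalFrom 0 la T → IsRowStandard la T
MaximalFrom⇒IsRowStandard {la} (shape , (rows , _) , entries , _) =
  shape , ↭.trans entries (↭.↭-reflexive (sym (map-suc-upTo (size la)))) , rows

proposition2p2 : (la : List ℕ) → IsPartition la →
    ((T : Tableau) → IsRowStandard la T → inversions T ≤ M la)
    × (∃[ T ] (IsRowStandard la T × inversions T ≡ M la
          × ((T' : Tableau) → IsRowStandard la T' → inversions T' ≡ M la → T' ≡ T)))
proposition2p2 la (_ , decreasing) =
  (λ _ → RowStandard⇒inversions≤M) ,
  (maximalTableau (width la) la 0 , standard , Maximal⇒inversions≡M standard maximal ,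
   λ _ rs eq → Maximal-unique decreasing rs standard (inversions≡M⇒Maximal rs eq) maximal)
  where
  built = maximalTableau-maximal (width la) la 0 decreasing (parts≤width la)
  standard = MaximalFrom⇒IsRowStandard built
  maximal = proj₁ (proj₂ built)
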